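{- Let $\mathbf{L}$ be a tense ICRDL-algebra. For a tense filter $S$ of $\mathbf{L}$ let $J_S=\{(x,y)\in K(L):x\in S,\ \neg y\in S\}$, and for a tense filter $J$ of $K(\mathbf{L})$ let $S_J=\{a\in L:(a,0)\in J\}$. Then the assignments $S\mapsto J_S$ and $J\mapsto S_J$ establish mutually inverse poset isomorphisms between $\mathrm{tFi}(\mathbf{L})$ and $\mathrm{tFi}(K(\mathbf{L}))$.
   Context: An ICRDL-algebra is a structure $\langle L,\vee,\wedge,\cdot,\to,0,1\rangle$ such that $\langle L,\vee,\wedge,0,1\rangle$ is a bounded distributive lattice, $\langle L,\cdot,1\rangle$ is a commutative monoid, and $x\cdot y\le z$ iff $x\le y\to z$; $\neg x:=x\to 0$. A tense ICRDL-algebra is an ICRDL-algebra with unary operations $G,H,F,P$ satisfying: (T1) $P(x)\le y$ iff $x\le G(y)$; (T2) $F(x)\le y$ iff $x\le H(y)$; (T3) $G(0)=0$, $H(0)=0$; (T4) $G(x)\cdot F(y)\le F(x\cdot y)$ and $H(x)\cdot P(y)\le P(x\cdot y)$; (T5) $G(x\vee y)\le G(x)\vee F(y)$ and $H(x\vee y)\le H(x)\vee P(y)$; (T6) $G(x\to y)\le G(x)\to G(y)$ and $H(x\to y)\le H(x)\to H(y)$. A tense filter of $\mathbf{L}$ is a nonempty up-set closed under $\cdot$, $G$ and $H$. $K(\mathbf{L})$ is the tense DRL-algebra on $K(L)=\{(a,b)\in L\times L:a\cdot b=0\}$ with $(a,b)\vee(x,y)=(a\vee x,b\wedge y)$, $(a,b)\wedge(x,y)=(a\wedge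 x,b\vee y)$, $(a,b)\ast(x,y)=(a\cdot x,(a\to y)\wedge(x\to b))$, $\sim(a,b)=(b,a)$, $0=(0,1)$, $1=(1,0)$, $c=(0,0)$, $G_K(a,b)=(G(a),F(b))$, $H_K(a,b)=(H(a),P(b))$; a tense filter of $K(\mathbf{L})$ is a nonempty up-set closed under $\ast$, $G_K$ and $H_K$. $\mathrm{tFi}(\cdot)$ denotes the poset of tense filters ordered by inclusion. -}

module Defs where

open import Level using (Level; suc; _⊔_)
open import Data.Product using (Σ; ∃; _×_; _,_; proj₁; proj₂)
open import Relation.Binary.PropositionalEquality using (_≡_)
open import Algebra.Lattice.Structures using (IsDistributiveLattice)
open import Algebra.Structures using (IsCommutativeMonoid)
open import Function.Bundles using (_⇔_)

record TenseICRDL (c : Level) : Set (suc c) where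
  infixr 6 _∨_
  infixr 7 _∧_
  infixr 8 _·_
  infixr 5 _⇒_
  infix 4 _≤_
  field
    Carrier : Set c
    _∨_ _∧_ _·_ _⇒_ : Carrier → Carrier → Carrier
    𝟘 𝟙 : Carrier
    G H F P : Carrier → Carrier

  _≤_ : Carrier → Carrier → Set c
  x ≤ y = x ∨ y ≡ y

  field
    isDistributiveLattice : IsDistributiveLattice _≡_ _∨_ _∧_
    𝟘-bottom : ∀ x → 𝟘 ≤ x
    𝟙-top    : ∀ x → x ≤ 𝟙
    isCommutativeMonoid : IsCommutativeMonoid _≡_ _·_ 𝟙
    residuated : ∀ x y z → (x · y ≤ z) ⇔ (x ≤ y ⇒ z)
    T1 : ∀ x y → (P x ≤ y) ⇔ (x ≤ G y)
    T2 : ∀ x y → (F x ≤ y) ⇔ (x ≤ H y)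
    T3-G : G 𝟘 ≡ 𝟘
    T3-H : H 𝟘 ≡ 𝟘
    T4-G : ∀ x y → G x · F y ≤ F (x · y)
    T4-H : ∀ x y → H x · P y ≤ P (x · y)
    T5-G : ∀ x y → G (x ∨ y) ≤ G x ∨ F y
    T5-H : ∀ x y → H (x ∨ y) ≤ H x ∨ P y
    T6-G : ∀ x y → G (x ⇒ y) ≤ G x ⇒ G y
    T6-H : ∀ x y → H (x ⇒ y) ≤ H x ⇒ H y

  ¬ₗ : Carrier → Carrier
  ¬ₗ x = x ⇒ 𝟘

module _ {c : Level} (L : TenseICRDL c) where
  open TenseICRDL L

  SubL : Set (suc c)
  SubL = Carrier → Set c

  SubK : Set (suc c)
  SubK = Carrier × Carrier → Set c

  record IsTenseFilter (S : SubL) : Set c where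
    field
      nonempty : ∃ λ a → S a
      upset    : ∀ {a b} → S a → a ≤ b → S b
      ·-closed : ∀ {a b} → S a → S b → S (a · b)
      G-closed : ∀ {a} → S a → S (G a)
      H-closed : ∀ {a} → S a → S (H a)

  InK : Carrier × Carrier → Set c
  InK (a , b) = a · b ≡ 𝟘

  _≤K_ : Carrier × Carrier → Carrier × Carrier → Set c
  (a , b) ≤K (x , y) = (a ≤ x) × (y ≤ b)

  _∗_ : Carrier × Carrier → Carrier × Carrier → Carrier × Carrier
  (a , b) ∗ (x , y) = (a · x , ((a ⇒ y) ∧ (x ⇒ b)))

  G-K : Carrier × Carrier → Carrier × Carrier
  G-K (a , b) = (G a , F b)

  H-K : Carrier × Carrier → Carrier × Carrier
  H-K (a , b) = (H a , P b)

  record IsTenseFilterK (J : SubK) : Set c where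
    field
      inK      : ∀ {p} → J p → InK p
      nonempty : ∃ λ p → J p
      upset    : ∀ {p q} → J p → InK q → p ≤K q → J q
      ∗-closed : ∀ {p q} → J p → J q → J (p ∗ q)
      G-closed : ∀ {p} → J p → J (G-K p)
      H-closed : ∀ {p} → J p → J (H-K p)

  J[_] : SubL → SubK
  J[ S ] (x , y) = InK (x , y) × S x × S (¬ₗ y)

  S[_] : SubK → SubL
  S[ J ] a = J (a , 𝟘)

  _⊆L_ : SubL → SubL → Set c
  S ⊆L T = ∀ a → S a → T a

  _⊆K_ : SubK → SubK → Set c
  J ⊆K J' = ∀ p → J p → J' p

  _≐L_ : SubL → SubL → Set c
  S ≐L T = ∀ a → S a ⇔ T a

  _≐K_ : SubK → SubK → Set c
  J ≐K J' = ∀ p → J p ⇔ J' p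

{-# OPTIONS --safe #-}

-- The identities a · 𝟘 = 𝟘 and a ≤ ¬𝟘 make
-- a ↦ (a , 𝟘) land in K(L) and in J_S, while T4 together with F 𝟘 = P 𝟘 = 𝟘
-- shows that G_K and H_K preserve K(L) and J_S. The pair (x , y) ∈ K(L) is
-- recovered from (x , 𝟘) and (¬y , 𝟘): both lie above it since x ≤ ¬y, and
-- (x , 𝟘) ∗ (¬y , 𝟘) = (x · ¬y , ¬x ∧ ¬¬y) lies below it. Hence a tense filter
-- of K(L) is determined by its elements of the form (a , 𝟘), and S_J and J_S
-- are mutually inverse.
module Submission where

open import Defs
open import Level using (Level)
open import Data.Product using (_×_; _,_; proj₁; proj₂)
open import Function.Bundles using (_⇔_; mk⇔; Equivalence)
open import Relation.Binary.Bundles using (Poset)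
open import Relation.Binary.PropositionalEquality
  using (_≡_; refl; sym; trans; cong; cong₂; isEquivalence)
open import Algebra.Structures using (IsCommutativeMonoid)
open import Algebra.Lattice.Structures using (IsDistributiveLattice)

module TenseICRDLProperties {c : Level} (L : TenseICRDL c) where
  open TenseICRDL L
  open IsDistributiveLattice isDistributiveLattice
    using (∨-comm; ∨-assoc; ∨-absorbs-∧; ∧-absorbs-∨; ∨-distribˡ-∧)
  open IsCommutativeMonoid isCommutativeMonoid using (assoc; comm; identityʳ)
  open Equivalence using (to; from)

  ≤-refl : ∀ {x} → x ≤ x
  ≤-refl {x} = trans (cong (x ∨_) (sym (∧-absorbs-∨ x x))) (∨-absorbs-∧ x (x ∨ x))

  ≤-reflexive : ∀ {x y} → x ≡ y → x ≤ y
  ≤-reflexive refl = ≤-refl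

  ≤-trans : ∀ {x y z} → x ≤ y → y ≤ z → x ≤ z
  ≤-trans {x} {y} {z} x≤y y≤z =
    trans (cong (x ∨_) (sym y≤z))
      (trans (sym (∨-assoc x y z)) (trans (cong (_∨ z) x≤y) y≤z))

  ≤-antisym : ∀ {x y} → x ≤ y → y ≤ x → x ≡ y
  ≤-antisym {x} {y} x≤y y≤x = trans (sym y≤x) (trans (∨-comm y x) x≤y)

  poset : Poset c c c
  poset = record
    { Carrier        = Carrier
    ; _≈_            = _≡_
    ; _≤_            = _≤_
    ; isPartialOrder = record
      { isPreorder = record
        { isEquivalence = isEquivalence
        ; reflexive     = ≤-reflexive
        ; trans         = ≤-trans
        }
      ; antisym = ≤-antisym
      }
    }

  open import Relation.Binary.Reasoning.PartialOrder poset

  x∧y≤x : ∀ {x y} → x ∧ y ≤ x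
  x∧y≤x {x} {y} = trans (∨-comm (x ∧ y) x) (∨-absorbs-∧ x y)

  ∧-greatest : ∀ {x y z} → x ≤ y → x ≤ z → x ≤ y ∧ z
  ∧-greatest {x} {y} {z} x≤y x≤z = trans (∨-distribˡ-∧ x y z) (cong₂ _∧_ x≤y x≤z)

  x≤𝟘⇒x≡𝟘 : ∀ {x} → x ≤ 𝟘 → x ≡ 𝟘
  x≤𝟘⇒x≡𝟘 x≤𝟘 = ≤-antisym x≤𝟘 (𝟘-bottom _)

  ·-monoˡ-≤ : ∀ {x y z} → x ≤ y → x · z ≤ y · z
  ·-monoˡ-≤ {x} {y} {z} x≤y =
    from (residuated x z (y · z)) (≤-trans x≤y (to (residuated y z (y · z)) ≤-refl))

  ·-monoʳ-≤ : ∀ {x y z} → x ≤ y → z · x ≤ z · y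
  ·-monoʳ-≤ {x} {y} {z} x≤y = begin
    z · x ≡⟨ comm z x ⟩
    x · z ≤⟨ ·-monoˡ-≤ x≤y ⟩
    y · z ≡⟨ comm y z ⟩
    z · y ∎

  ·-zeroʳ : ∀ x → x · 𝟘 ≡ 𝟘
  ·-zeroʳ x = x≤𝟘⇒x≡𝟘 (begin
    x · 𝟘 ≡⟨ comm x 𝟘 ⟩
    𝟘 · x ≤⟨ from (residuated 𝟘 x 𝟘) (𝟘-bottom _) ⟩
    𝟘     ∎)

  x·[x⇒y]≤y : ∀ {x y} → x · (x ⇒ y) ≤ y
  x·[x⇒y]≤y {x} {y} = begin
    x · (x ⇒ y) ≡⟨ comm x (x ⇒ y) ⟩
    (x ⇒ y) · x ≤⟨ from (residuated (x ⇒ y) x y) ≤-refl ⟩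
    y           ∎

  x·y≤x : ∀ {x y} → y ≤ 𝟙 → x · y ≤ x
  x·y≤x {x} {y} y≤𝟙 = begin
    x · y ≤⟨ ·-monoʳ-≤ y≤𝟙 ⟩
    x · 𝟙 ≡⟨ identityʳ x ⟩
    x     ∎

  ·≡𝟘⇒≤¬ : ∀ {x y} → x · y ≡ 𝟘 → x ≤ ¬ₗ y
  ·≡𝟘⇒≤¬ x·y≡𝟘 = to (residuated _ _ _) (≤-reflexive x·y≡𝟘)

  x≤¬𝟘 : ∀ {x} → x ≤ ¬ₗ 𝟘
  x≤¬𝟘 = ·≡𝟘⇒≤¬ (·-zeroʳ _)

  x≤¬¬x : ∀ {x} → x ≤ ¬ₗ (¬ₗ x)
  x≤¬¬x = to (residuated _ _ _) x·[x⇒y]≤y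

  ¬-antitone : ∀ {x y} → x ≤ y → ¬ₗ y ≤ ¬ₗ x
  ¬-antitone {x} {y} x≤y = to (residuated _ _ _) (begin
    ¬ₗ y · x ≤⟨ ·-monoʳ-≤ x≤y ⟩
    ¬ₗ y · y ≡⟨ comm (¬ₗ y) y ⟩
    y · ¬ₗ y ≤⟨ x·[x⇒y]≤y ⟩
    𝟘        ∎)

  x·¬y≤¬[x⇒y] : ∀ {x y} → x · ¬ₗ y ≤ ¬ₗ (x ⇒ y)
  x·¬y≤¬[x⇒y] {x} {y} = to (residuated _ _ _) (begin
    (x · ¬ₗ y) · (x ⇒ y) ≡⟨ cong (_· (x ⇒ y)) (comm x (¬ₗ y)) ⟩
    (¬ₗ y · x) · (x ⇒ y) ≡⟨ assoc (¬ₗ y) x (x ⇒ y) ⟩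
    ¬ₗ y · (x · (x ⇒ y)) ≤⟨ ·-monoʳ-≤ x·[x⇒y]≤y ⟩
    ¬ₗ y · y             ≡⟨ comm (¬ₗ y) y ⟩
    y · ¬ₗ y             ≤⟨ x·[x⇒y]≤y ⟩
    𝟘                    ∎)

  lowerAdjoint-preserves-𝟘 : ∀ {f g : Carrier → Carrier} → (∀ x y → (f x ≤ y) ⇔ (x ≤ g y)) → f 𝟘 ≡ 𝟘
  lowerAdjoint-preserves-𝟘 f⊣g = x≤𝟘⇒x≡𝟘 (from (f⊣g 𝟘 𝟘) (𝟘-bottom _))

  F-𝟘 : F 𝟘 ≡ 𝟘
  F-𝟘 = lowerAdjoint-preserves-𝟘 {F} {H} T2

  P-𝟘 : P 𝟘 ≡ 𝟘
  P-𝟘 = lowerAdjoint-preserves-𝟘 {P} {G} T1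

  module _ {g f : Carrier → Carrier} (f𝟘≡𝟘 : f 𝟘 ≡ 𝟘)
           (g·f≤f· : ∀ x y → g x · f y ≤ f (x · y)) where

    ·≡𝟘⇒g·f≡𝟘 : ∀ {x y} → x · y ≡ 𝟘 → g x · f y ≡ 𝟘
    ·≡𝟘⇒g·f≡𝟘 {x} {y} x·y≡𝟘 = x≤𝟘⇒x≡𝟘 (begin
      g x · f y ≤⟨ g·f≤f· x y ⟩
      f (x · y) ≡⟨ cong f x·y≡𝟘 ⟩
      f 𝟘       ≡⟨ f𝟘≡𝟘 ⟩
      𝟘         ∎)

    g¬≤¬f : ∀ {y} → g (¬ₗ y) ≤ ¬ₗ (f y)
    g¬≤¬f {y} = ·≡𝟘⇒≤¬ (·≡𝟘⇒g·f≡𝟘 (trans (comm (¬ₗ y) y) (x≤𝟘⇒x≡𝟘 x·[x⇒y]≤y)))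

  ∗-preserves-InK : ∀ {a b x y} → x · y ≡ 𝟘 → (a · x) · ((a ⇒ y) ∧ (x ⇒ b)) ≡ 𝟘
  ∗-preserves-InK {a} {b} {x} {y} x·y≡𝟘 = x≤𝟘⇒x≡𝟘 (begin
    (a · x) · ((a ⇒ y) ∧ (x ⇒ b)) ≡⟨ cong (_· _) (comm a x) ⟩
    (x · a) · ((a ⇒ y) ∧ (x ⇒ b)) ≡⟨ assoc x a _ ⟩
    x · (a · ((a ⇒ y) ∧ (x ⇒ b))) ≤⟨ ·-monoʳ-≤ (·-monoʳ-≤ x∧y≤x) ⟩
    x · (a · (a ⇒ y))             ≤⟨ ·-monoʳ-≤ x·[x⇒y]≤y ⟩
    x · y                         ≡⟨ x·y≡𝟘 ⟩
    𝟘                             ∎)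

module TenseFilterProperties {c : Level} (L : TenseICRDL c) where
  open TenseICRDL L
  open TenseICRDLProperties L
  open IsCommutativeMonoid isCommutativeMonoid using (comm)

  J[]-mono : ∀ {S T} → _⊆L_ L S T → _⊆K_ L (J[_] L S) (J[_] L T)
  J[]-mono S⊆T (x , y) (x·y≡𝟘 , x∈S , ¬y∈S) = x·y≡𝟘 , S⊆T x x∈S , S⊆T (¬ₗ y) ¬y∈S

  S[]-mono : ∀ {J J'} → _⊆K_ L J J' → _⊆L_ L (S[_] L J) (S[_] L J')
  S[]-mono J⊆J' a = J⊆J' (a , 𝟘)

  module _ {S : SubL L} (isS : IsTenseFilter L S) where
    open IsTenseFilter isS

    𝟙∈S : S 𝟙
    𝟙∈S = upset (proj₂ nonempty) (𝟙-top _)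

    J[S]-upset : ∀ {p q} → J[_] L S p → InK L q → _≤K_ L p q → J[_] L S q
    J[S]-upset {x , y} {x' , y'} (_ , x∈S , ¬y∈S) x'·y'≡𝟘 (x≤x' , y'≤y) =
      x'·y'≡𝟘 , upset x∈S x≤x' , upset ¬y∈S (¬-antitone y'≤y)

    J[S]-∗-closed : ∀ {p q} → J[_] L S p → J[_] L S q → J[_] L S (_∗_ L p q)
    J[S]-∗-closed {x , y} {x' , y'} (_ , x∈S , ¬y∈S) (x'·y'≡𝟘 , x'∈S , ¬y'∈S) =
      ∗-preserves-InK x'·y'≡𝟘 ,
      ·-closed x∈S x'∈S ,
      upset (·-closed x∈S ¬y'∈S) (≤-trans x·¬y≤¬[x⇒y] (¬-antitone x∧y≤x))

    J[S]-conjugate-closed : ∀ {g f : Carrier → Carrier} → f 𝟘 ≡ 𝟘 →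
      (∀ x y → g x · f y ≤ f (x · y)) → (∀ {a} → S a → S (g a)) →
      ∀ {x y} → J[_] L S (x , y) → J[_] L S (g x , f y)
    J[S]-conjugate-closed f𝟘≡𝟘 g·f≤f· g-closed (x·y≡𝟘 , x∈S , ¬y∈S) =
      ·≡𝟘⇒g·f≡𝟘 f𝟘≡𝟘 g·f≤f· x·y≡𝟘 ,
      g-closed x∈S ,
      upset (g-closed ¬y∈S) (g¬≤¬f f𝟘≡𝟘 g·f≤f·)

    J[]-isTenseFilterK : IsTenseFilterK L (J[_] L S)
    J[]-isTenseFilterK = record
      { inK      = proj₁
      ; nonempty = (𝟙 , 𝟘) , ·-zeroʳ 𝟙 , 𝟙∈S , upset 𝟙∈S x≤¬𝟘
      ; upset    = J[S]-upset
      ; ∗-closed = J[S]-∗-closed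
      ; G-closed = λ { {_ , _} → J[S]-conjugate-closed F-𝟘 T4-G G-closed }
      ; H-closed = λ { {_ , _} → J[S]-conjugate-closed P-𝟘 T4-H H-closed }
      }

    S[J[S]]≐S : _≐L_ L (S[_] L (J[_] L S)) S
    S[J[S]]≐S a = mk⇔ (λ (_ , a∈S , _) → a∈S) (λ a∈S → ·-zeroʳ a , a∈S , upset a∈S x≤¬𝟘)

  module _ {J : SubK L} (isJ : IsTenseFilterK L J) where
    open IsTenseFilterK isJ

    [a,y]∈J⇒[b,𝟘]∈J : ∀ {a y b} → J (a , y) → a ≤ b → J (b , 𝟘)
    [a,y]∈J⇒[b,𝟘]∈J [a,y]∈J a≤b = upset [a,y]∈J (·-zeroʳ _) (a≤b , 𝟘-bottom _)

    S[]-isTenseFilter : IsTenseFilter L (S[_] L J)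
    S[]-isTenseFilter = record
      { nonempty = 𝟙 , [a,y]∈J⇒[b,𝟘]∈J (proj₂ nonempty) (𝟙-top _)
      ; upset    = [a,y]∈J⇒[b,𝟘]∈J
      ; ·-closed = λ a∈ b∈ → [a,y]∈J⇒[b,𝟘]∈J (∗-closed a∈ b∈) ≤-refl
      ; G-closed = λ a∈ → [a,y]∈J⇒[b,𝟘]∈J (G-closed a∈) ≤-refl
      ; H-closed = λ a∈ → [a,y]∈J⇒[b,𝟘]∈J (H-closed a∈) ≤-refl
      }

    J[S[J]]≐J : _≐K_ L (J[_] L (S[_] L J)) J
    J[S[J]]≐J (x , y) = mk⇔ recombine decompose
      where
      recombine : J[_] L (S[_] L J) (x , y) → J (x , y)
      recombine (x·y≡𝟘 , [x,𝟘]∈J , [¬y,𝟘]∈J) =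
        upset (∗-closed [x,𝟘]∈J [¬y,𝟘]∈J) x·y≡𝟘
          (x·y≤x (𝟙-top _) , ∧-greatest (·≡𝟘⇒≤¬ (trans (comm y x) x·y≡𝟘)) x≤¬¬x)

      decompose : J (x , y) → J[_] L (S[_] L J) (x , y)
      decompose [x,y]∈J =
        inK [x,y]∈J , [a,y]∈J⇒[b,𝟘]∈J [x,y]∈J ≤-refl , [a,y]∈J⇒[b,𝟘]∈J [x,y]∈J (·≡𝟘⇒≤¬ (inK [x,y]∈J))

mainTheorem19 : {c : Level} (L : TenseICRDL c) →
    -- S ↦ J_S maps tFi(L) into tFi(K(L))
    ((S : SubL L) → IsTenseFilter L S → IsTenseFilterK L (J[_] L S))
    -- J ↦ S_J maps tFi(K(L)) into tFi(L)
    × ((J : SubK L) → IsTenseFilterK L J → IsTenseFilter L (S[_] L J))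
    -- both assignments are monotone
    × ((S T : SubL L) → IsTenseFilter L S → IsTenseFilter L T →
         _⊆L_ L S T → _⊆K_ L (J[_] L S) (J[_] L T))
    × ((J J' : SubK L) → IsTenseFilterK L J → IsTenseFilterK L J' →
         _⊆K_ L J J' → _⊆L_ L (S[_] L J) (S[_] L J'))
    -- and mutually inverse
    × ((S : SubL L) → IsTenseFilter L S → _≐L_ L (S[_] L (J[_] L S)) S)
    × ((J : SubK L) → IsTenseFilterK L J → _≐K_ L (J[_] L (S[_] L J)) J)
mainTheorem19 L =
    (λ _ → J[]-isTenseFilterK)
  , (λ _ → S[]-isTenseFilter)
  , (λ _ _ _ _ → J[]-mono)
  , (λ _ _ _ _ → S[]-mono)
  , (λ _ → S[J[S]]≐S)
  , (λ _ → J[S[J]]≐J)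
  where open TenseFilterProperties L
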